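{- Let $m'=6j+1$ be a prime, where $j$ is a positive integer, and let $s$ be an integer with $s^2\equiv-3\pmod{m'}$. Then for every integer $n\ge0$, $$p(n,3)\equiv0\pmod{m'}\quad\Longleftrightarrow\quad n\equiv\varepsilon a\pmod{6m'}\ \text{ for some }\varepsilon\in\{1,-1\}\text{ and } a\in\{0,1,2,2m'-1,2m'+2,3m'+s(m'-1)\}.$$
   Context: $p(n,3)$ denotes the number of partitions of the nonnegative integer $n$ into exactly three positive parts, i.e. the number of integer triples $(\lambda_1,\lambda_2,\lambda_3)$ with $\lambda_1\ge\lambda_2\ge\lambda_3>0$ and $\lambda_1+\lambda_2+\lambda_3=n$. -}

module Defs where

open import Data.Nat as ℕ using (ℕ; _≤_; _≥_; _>_; _+_; _≤?_; _≟_; _>?_)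
open import Data.List using (List; length; filter; upTo; concatMap; map; [_])
open import Data.Product using (_×_; _,_)
open import Relation.Nullary.Decidable using (_×-dec_)
open import Relation.Binary.PropositionalEquality using (_≡_)
open import Data.Integer as ℤ using (ℤ)
open import Data.Integer.Divisibility using (_∣_)

triples : ℕ → List (ℕ × ℕ × ℕ)
triples n = concatMap (λ a → concatMap (λ b → map (λ c → (a , b , c)) (upTo (ℕ.suc n))) (upTo (ℕ.suc n))) (upTo (ℕ.suc n))

IsPart3 : ℕ → ℕ × ℕ × ℕ → Set
IsPart3 n (a , b , c) = (a ≥ b × b ≥ c × c > 0) × a + b + c ≡ n

isPart3? : ∀ n t → Relation.Nullary.Decidable.Dec (IsPart3 n t)
isPart3? n (a , b , c) = ((b ≤? a) ×-dec ((c ≤? b) ×-dec (0 ℕ.<? c))) ×-dec ((a + b + c) ≟ n)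

p3 : ℕ → ℕ
p3 n = length (filter (isPart3? n) (triples n))

_≡_[mod_] : ℤ → ℤ → ℤ → Set
x ≡ y [mod m ] = m ∣ (x ℤ.- y)

module Submission where

-- Counting partitions by their middle part b gives p(n+3,3) = p(n,3) + ⌊n/2⌋ + 1, hence
-- 12 p(n,3) = n² + δ(n) with δ(n) ∈ {0, -1, -4, 3, -4, -1} depending only on n mod 6.
-- Since the prime m' is prime to 12, m' ∣ p(n,3) means n² ≡ -δ(n) (mod m'), and -δ(n) has
-- the square roots ±α modulo m' with α ∈ {0, 1, 2, s}.  For each class r of n modulo 6,
-- the two roots ±α are represented by two of the ±a lying in the class r modulo 6, so by the
-- Chinese remainder theorem the solutions are exactly n ≡ ±a (mod 6m').

open import Defs
open import Data.Product using (Σ; Σ-syntax; _×_; _,_; proj₁; proj₂)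
open import Data.Sum as Sum using (_⊎_; inj₁; inj₂)
open import Data.Empty using (⊥-elim)
open import Function using (_∘_; id; _∋_; _⇔_; mk⇔; Equivalence)
open import Relation.Nullary using (Dec; yes; no; ¬_; contradiction)
open import Relation.Binary.PropositionalEquality
open import Data.List using (List; []; _∷_)
open ≡-Reasoning

module PartitionFormula where

  open import Data.Nat using (ℕ; zero; suc; _+_; _*_; _∸_; _⊓_; _≤_; _<_; _≤?_; z≤n; s≤s; s≤s⁻¹; ⌊_/2⌋; _%_; _/_)
  open import Data.Nat.DivMod using (m≡m%n+[m/n]*n)
  open import Data.Nat.Properties
  open import Data.List using (length; filter; concatMap; applyUpTo; upTo; _++_; map)
  open import Data.List.Properties using (length-++; filter-++; map-applyUpTo)
  open import Data.Integer as ℤ using (ℤ; +_; -_)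
  import Data.Integer.Properties as ℤP
  open import Data.Integer.Tactic.RingSolver using (solve)
  open import Algebra.Properties.CommutativeSemigroup +-commutativeSemigroup using (interchange)

  ∑< : ℕ → (ℕ → ℕ) → ℕ
  ∑< zero    f = 0
  ∑< (suc n) f = f 0 + ∑< n (f ∘ suc)

  syntax ∑< n (λ i → e) = ∑[ i < n ] e

  ∑-cong : ∀ n {f g : ℕ → ℕ} → (∀ i → f i ≡ g i) → ∑< n f ≡ ∑< n g
  ∑-cong zero    f≗g = refl
  ∑-cong (suc n) f≗g = cong₂ _+_ (f≗g 0) (∑-cong n (f≗g ∘ suc))

  ∑-zero : ∀ n {f : ℕ → ℕ} → (∀ i → f i ≡ 0) → ∑< n f ≡ 0
  ∑-zero zero    f≗0 = refl
  ∑-zero (suc n) f≗0 = cong₂ _+_ (f≗0 0) (∑-zero n (f≗0 ∘ suc))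

  ∑-distrib-+ : ∀ n (f g : ℕ → ℕ) → ∑[ i < n ] (f i + g i) ≡ ∑< n f + ∑< n g
  ∑-distrib-+ zero    f g = refl
  ∑-distrib-+ (suc n) f g = begin
    f 0 + g 0 + ∑[ i < n ] (f (suc i) + g (suc i))        ≡⟨ cong (_+_ (f 0 + g 0)) (∑-distrib-+ n (f ∘ suc) (g ∘ suc)) ⟩
    f 0 + g 0 + (∑< n (f ∘ suc) + ∑< n (g ∘ suc))         ≡⟨ interchange (f 0) (g 0) _ _ ⟩
    f 0 + ∑< n (f ∘ suc) + (g 0 + ∑< n (g ∘ suc))         ∎

  ∑-comm : ∀ m n (f : ℕ → ℕ → ℕ) → ∑[ i < m ] ∑[ j < n ] f i j ≡ ∑[ j < n ] ∑[ i < m ] f i j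
  ∑-comm zero    n f = sym (∑-zero n (λ _ → refl))
  ∑-comm (suc m) n f = begin
    ∑< n (f 0) + ∑[ i < m ] ∑[ j < n ] f (suc i) j   ≡⟨ cong (_+_ (∑< n (f 0))) (∑-comm m n (f ∘ suc)) ⟩
    ∑< n (f 0) + ∑[ j < n ] ∑[ i < m ] f (suc i) j   ≡⟨ ∑-distrib-+ n (f 0) _ ⟨
    ∑[ j < n ] ∑[ i < suc m ] f i j                  ∎

  ∑-vanishing : ∀ {m n} {f : ℕ → ℕ} → m ≤ n → (∀ i → m ≤ i → f i ≡ 0) → ∑< n f ≡ ∑< m f
  ∑-vanishing {n = n} z≤n       f≗0 = ∑-zero n (λ i → f≗0 i z≤n)
  ∑-vanishing {f = f} (s≤s m≤n) f≗0 = cong (_+_ (f 0)) (∑-vanishing m≤n (λ i m≤i → f≗0 (suc i) (s≤s m≤i)))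

  𝟙 : ∀ {p} {P : Set p} → Dec P → ℕ
  𝟙 (yes _) = 1
  𝟙 (no _)  = 0

  𝟙-yes : ∀ {P : Set} (P? : Dec P) → P → 𝟙 P? ≡ 1
  𝟙-yes (yes _) _ = refl
  𝟙-yes (no ¬p) p = ⊥-elim (¬p p)

  𝟙-no : ∀ {P : Set} (P? : Dec P) → ¬ P → 𝟙 P? ≡ 0
  𝟙-no (yes p) ¬p = ⊥-elim (¬p p)
  𝟙-no (no _)  _  = refl

  ∑-𝟙-unique : ∀ {n k} {P : ℕ → Set} (P? : ∀ i → Dec (P i)) → k < n → (∀ i → P i → i ≡ k) →
                ∑[ i < n ] 𝟙 (P? i) ≡ 𝟙 (P? k)
  ∑-𝟙-unique {suc n} {zero}  P? _         only-k = begin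
    𝟙 (P? 0) + ∑[ i < n ] 𝟙 (P? (suc i))   ≡⟨ cong (_+_ (𝟙 (P? 0))) (∑-zero n λ i → 𝟙-no (P? (suc i)) λ p → 1+n≢0 (only-k (suc i) p)) ⟩
    𝟙 (P? 0) + 0                           ≡⟨ +-identityʳ _ ⟩
    𝟙 (P? 0)                               ∎
  ∑-𝟙-unique {suc n} {suc k} P? (s≤s k<n) only-k =
    cong₂ _+_ (𝟙-no (P? 0) λ p → 0≢1+n (only-k 0 p))
              (∑-𝟙-unique (P? ∘ suc) k<n λ i p → suc-injective (only-k (suc i) p))

  ∑-𝟙-initial : ∀ {n l} {P : ℕ → Set} (P? : ∀ i → Dec (P i)) → l ≤ n → (∀ i → P i ⇔ i < l) →
                 ∑[ i < n ] 𝟙 (P? i) ≡ l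
  ∑-𝟙-initial {n} P? z≤n P⇔<0 = ∑-zero n λ i → 𝟙-no (P? i) λ p → n≮0 (Equivalence.to (P⇔<0 i) p)
  ∑-𝟙-initial P? (s≤s l≤n) P⇔<l =
    cong₂ _+_ (𝟙-yes (P? 0) (Equivalence.from (P⇔<l 0) (s≤s z≤n)))
              (∑-𝟙-initial (P? ∘ suc) l≤n λ i → mk⇔ (s≤s⁻¹ ∘ Equivalence.to (P⇔<l (suc i)))
                                                    (Equivalence.from (P⇔<l (suc i)) ∘ s≤s))

  module _ {A : Set} {P : A → Set} (P? : ∀ x → Dec (P x)) where

    length-filter-applyUpTo : ∀ (g : ℕ → A) n → length (filter P? (applyUpTo g n)) ≡ ∑[ i < n ] 𝟙 (P? (g i))
    length-filter-applyUpTo g zero = refl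
    length-filter-applyUpTo g (suc n) with P? (g 0)
    ... | yes _ = cong suc (length-filter-applyUpTo (g ∘ suc) n)
    ... | no  _ = length-filter-applyUpTo (g ∘ suc) n

    length-filter-concatMap-applyUpTo : ∀ {B : Set} (f : B → List A) (g : ℕ → B) n →
      length (filter P? (concatMap f (applyUpTo g n))) ≡ ∑[ i < n ] length (filter P? (f (g i)))
    length-filter-concatMap-applyUpTo f g zero    = refl
    length-filter-concatMap-applyUpTo f g (suc n) = begin
      length (filter P? (f (g 0) ++ rest))
        ≡⟨ cong length (filter-++ P? (f (g 0)) rest) ⟩
      length (filter P? (f (g 0)) ++ filter P? rest)
        ≡⟨ length-++ (filter P? (f (g 0))) ⟩
      length (filter P? (f (g 0))) + length (filter P? rest)
        ≡⟨ cong (_+_ _) (length-filter-concatMap-applyUpTo f (g ∘ suc) n) ⟩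
      ∑[ i < suc n ] length (filter P? (f (g i)))
        ∎
      where
      rest : List A
      rest = concatMap f (applyUpTo (g ∘ suc) n)

  p3≡∑∑∑ : ∀ n → p3 n ≡ ∑[ a < suc n ] ∑[ b < suc n ] ∑[ c < suc n ] 𝟙 (isPart3? n (a , b , c))
  p3≡∑∑∑ n =
    trans (count (λ a → concatMap (λ b → map (λ c → a , b , c) (upTo N)) (upTo N))) (∑-cong N λ a →
    trans (count (λ b → map (λ c → a , b , c) (upTo N))) (∑-cong N λ b →
    trans (cong (length ∘ filter (isPart3? n)) (map-applyUpTo id (λ c → a , b , c) N))
          (length-filter-applyUpTo (isPart3? n) (λ c → a , b , c) N)))
    where
    N : ℕ
    N = suc n
    count : ∀ f → length (filter (isPart3? n) (concatMap f (upTo N))) ≡ ∑[ i < N ] length (filter (isPart3? n) (f i))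
    count f = length-filter-concatMap-applyUpTo (isPart3? n) f id N

  IsPart3-shape : ∀ {n a b c} → IsPart3 n (a , b , c) → c ≤ b × 0 < c × b + b + c ≤ n
  IsPart3-shape {a = a} {b} {c} ((b≤a , c≤b , 0<c) , sum≡n) =
    c≤b , 0<c , subst (b + b + c ≤_) sum≡n (+-monoˡ-≤ c (+-monoˡ-≤ b b≤a))

  IsPart3-largest : ∀ {n a b c} → IsPart3 n (a , b , c) → a ≡ n ∸ (b + c)
  IsPart3-largest {a = a} {b} {c} (_ , sum≡n) =
    sym (trans (cong (_∸ (b + c)) (trans (sym sum≡n) (+-assoc a b c))) (m+n∸n≡m a (b + c)))

  IsPart3-fromShape : ∀ {n b c} → c ≤ b × 0 < c × b + b + c ≤ n → IsPart3 n (n ∸ (b + c) , b , c)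
  IsPart3-fromShape {n} {b} {c} (c≤b , 0<c , 2b+c≤n) =
    (m+n≤o⇒m≤o∸n b b+[b+c]≤n , c≤b , 0<c) ,
    trans (+-assoc (n ∸ (b + c)) b c) (m∸n+n≡m (m+n≤o⇒n≤o b b+[b+c]≤n))
    where
    b+[b+c]≤n : b + (b + c) ≤ n
    b+[b+c]≤n = subst (_≤ n) (+-assoc b b c) 2b+c≤n

  0<m∸n⇒n≤m : ∀ m n → 0 < m ∸ n → n ≤ m
  0<m∸n⇒n≤m m       zero    _   = z≤n
  0<m∸n⇒n≤m (suc m) (suc n) 0<d = s≤s (0<m∸n⇒n≤m m n 0<d)

  -- the number of partitions of n into three parts with middle part b: the smallest part ranges over 1 … middle n b,
  -- and the largest is then n - b - smallest
  middle : ℕ → ℕ → ℕ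
  middle n b = b ⊓ (n ∸ (b + b))

  ∑-largest : ∀ n b c → ∑[ a < suc n ] 𝟙 (isPart3? n (a , b , c)) ≡ 𝟙 (isPart3? n (n ∸ (b + c) , b , c))
  ∑-largest n b c = ∑-𝟙-unique (λ a → isPart3? n (a , b , c)) (s≤s (m∸n≤m n (b + c))) (λ a → IsPart3-largest)

  IsPart3-smallest⇔ : ∀ n b c → IsPart3 n (n ∸ (b + suc c) , b , suc c) ⇔ c < middle n b
  IsPart3-smallest⇔ n b c = mk⇔
    (λ p → let (1+c≤b , _ , 2b+1+c≤n) = IsPart3-shape p in
           ⊓-glb 1+c≤b (m+n≤o⇒m≤o∸n (suc c) (subst (_≤ n) (+-comm (b + b) (suc c)) 2b+1+c≤n)))
    (λ c<middle → let 1+c≤n∸2b = ≤-trans c<middle (m⊓n≤n b _) in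
       IsPart3-fromShape (≤-trans c<middle (m⊓n≤m b _) , s≤s z≤n ,
         subst (_≤ n) (+-comm (suc c) (b + b))
           (m≤o∸n⇒m+n≤o (suc c) (0<m∸n⇒n≤m n (b + b) (≤-trans (s≤s z≤n) 1+c≤n∸2b)) 1+c≤n∸2b)))

  ∑-smallest : ∀ n b → ∑[ c < suc n ] 𝟙 (isPart3? n (n ∸ (b + c) , b , c)) ≡ middle n b
  ∑-smallest n b =
    cong₂ _+_ (𝟙-no (isPart3? n (n ∸ (b + 0) , b , 0)) λ p → n≮0 (proj₁ (proj₂ (IsPart3-shape p))))
              (∑-𝟙-initial (λ c → isPart3? n (n ∸ (b + suc c) , b , suc c))
                           (≤-trans (m⊓n≤n b _) (m∸n≤m n (b + b))) (IsPart3-smallest⇔ n b))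

  p3≡∑middle : ∀ n → p3 n ≡ ∑[ b < suc n ] middle n b
  p3≡∑middle n = begin
    p3 n
      ≡⟨ p3≡∑∑∑ n ⟩
    ∑[ a < suc n ] ∑[ b < suc n ] ∑[ c < suc n ] 𝟙 (isPart3? n (a , b , c))
      ≡⟨ ∑-comm (suc n) (suc n) (λ a b → ∑[ c < suc n ] 𝟙 (isPart3? n (a , b , c))) ⟩
    ∑[ b < suc n ] ∑[ a < suc n ] ∑[ c < suc n ] 𝟙 (isPart3? n (a , b , c))
      ≡⟨ ∑-cong (suc n) (λ b → ∑-comm (suc n) (suc n) (λ a c → 𝟙 (isPart3? n (a , b , c)))) ⟩
    ∑[ b < suc n ] ∑[ c < suc n ] ∑[ a < suc n ] 𝟙 (isPart3? n (a , b , c))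
      ≡⟨ ∑-cong (suc n) (λ b → ∑-cong (suc n) (∑-largest n b)) ⟩
    ∑[ b < suc n ] ∑[ c < suc n ] 𝟙 (isPart3? n (n ∸ (b + c) , b , c))
      ≡⟨ ∑-cong (suc n) (∑-smallest n) ⟩
    ∑[ b < suc n ] middle n b
      ∎

  middle-vanishes : ∀ n b → n < b + b → middle n b ≡ 0
  middle-vanishes n b n<2b = trans (cong (b ⊓_) (m≤n⇒m∸n≡0 (<⇒≤ n<2b))) (⊓-zeroʳ b)

  middle-shift : ∀ n b → middle (3 + n) (suc b) ≡ middle n b + 𝟙 (b + b ≤? n)
  middle-shift n b with b + b ≤? n
  ... | yes 2b≤n = begin
    suc b ⊓ (suc (suc n) ∸ (b + suc b)) ≡⟨ cong (λ x → suc b ⊓ (suc (suc n) ∸ x)) (+-suc b b) ⟩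
    suc b ⊓ (suc n ∸ (b + b))           ≡⟨ cong (suc b ⊓_) (+-∸-assoc 1 2b≤n) ⟩
    suc (middle n b)                    ≡⟨ +-comm 1 _ ⟩
    middle n b + 1                      ∎
  ... | no 2b≰n = begin
    suc b ⊓ (suc (suc n) ∸ (b + suc b)) ≡⟨ cong (λ x → suc b ⊓ (suc (suc n) ∸ x)) (+-suc b b) ⟩
    suc b ⊓ (suc n ∸ (b + b))           ≡⟨ cong (suc b ⊓_) (m≤n⇒m∸n≡0 (≰⇒> 2b≰n)) ⟩
    suc b ⊓ 0                           ≡⟨ ⊓-zeroʳ (suc b) ⟩
    0                                   ≡⟨ middle-vanishes n b (≰⇒> 2b≰n) ⟨
    middle n b                          ≡⟨ +-identityʳ _ ⟨
    middle n b + 0                      ∎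

  b+b≤n⇔b≤⌊n/2⌋ : ∀ n b → b + b ≤ n ⇔ b < suc ⌊ n /2⌋
  b+b≤n⇔b≤⌊n/2⌋ n b = mk⇔
    (λ 2b≤n → s≤s (subst (_≤ ⌊ n /2⌋) (sym (n≡⌊n+n/2⌋ b)) (⌊n/2⌋-mono 2b≤n)))
    (λ { (s≤s b≤⌊n/2⌋) → subst (b + b ≤_) (⌊n/2⌋+⌈n/2⌉≡n n)
                           (+-mono-≤ b≤⌊n/2⌋ (≤-trans b≤⌊n/2⌋ (⌊n/2⌋≤⌈n/2⌉ n))) })

  p3-shift : ∀ n → p3 (3 + n) ≡ p3 n + suc ⌊ n /2⌋
  p3-shift n = begin
    p3 (3 + n)                                                ≡⟨ p3≡∑middle (3 + n) ⟩
    ∑[ b < 3 + n ] middle (3 + n) (suc b)                     ≡⟨ ∑-cong (3 + n) (middle-shift n) ⟩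
    ∑[ b < 3 + n ] (middle n b + 𝟙 (b + b ≤? n))              ≡⟨ ∑-distrib-+ (3 + n) (middle n) (λ b → 𝟙 (b + b ≤? n)) ⟩
    ∑[ b < 3 + n ] middle n b + ∑[ b < 3 + n ] 𝟙 (b + b ≤? n) ≡⟨ cong₂ _+_ middle-sum half-count ⟩
    p3 n + suc ⌊ n /2⌋                                        ∎
    where
    middle-sum : ∑[ b < 3 + n ] middle n b ≡ p3 n
    middle-sum = trans (∑-vanishing (m≤n+m (suc n) 2) λ b n<b → middle-vanishes n b (≤-trans n<b (m≤m+n b b)))
                       (sym (p3≡∑middle n))
    half-count : ∑[ b < 3 + n ] 𝟙 (b + b ≤? n) ≡ suc ⌊ n /2⌋
    half-count = ∑-𝟙-initial (λ b → b + b ≤? n) (s≤s (≤-trans (⌊n/2⌋≤n n) (m≤n+m n 2))) (b+b≤n⇔b≤⌊n/2⌋ n)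

  -- δ n = 12 p(n,3) - n², which depends only on n mod 6
  δ : ℕ → ℤ
  δ 0 = + 0
  δ 1 = - + 1
  δ 2 = - + 4
  δ 3 = + 3
  δ 4 = - + 4
  δ 5 = - + 1
  δ (suc (suc (suc (suc (suc (suc n)))))) = δ n

  δ-periodic : ∀ k r → δ (k * 6 + r) ≡ δ r
  δ-periodic zero    r = refl
  δ-periodic (suc k) r = δ-periodic k r

  δ-mod : ∀ n → δ n ≡ δ (n % 6)
  δ-mod n = trans (cong δ (trans (m≡m%n+[m/n]*n n 6) (+-comm (n % 6) _))) (δ-periodic (n / 6) (n % 6))

  δ-shift : ∀ n → + (3 + n) ℤ.* + (3 + n) ℤ.+ δ (3 + n) ≡ + n ℤ.* + n ℤ.+ δ n ℤ.+ + 12 ℤ.* + suc ⌊ n /2⌋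
  δ-shift 0 = refl
  δ-shift 1 = refl
  δ-shift 2 = refl
  δ-shift 3 = refl
  δ-shift 4 = refl
  δ-shift 5 = refl
  δ-shift (suc (suc (suc (suc (suc (suc n)))))) = shift-by-6 (+ n) (δ n) (δ (3 + n)) (+ suc ⌊ n /2⌋) (δ-shift n)
    where
    shift-by-6 : ∀ x d d′ h → (+ 3 ℤ.+ x) ℤ.* (+ 3 ℤ.+ x) ℤ.+ d′ ≡ x ℤ.* x ℤ.+ d ℤ.+ + 12 ℤ.* h →
                 (+ 9 ℤ.+ x) ℤ.* (+ 9 ℤ.+ x) ℤ.+ d′ ≡ (+ 6 ℤ.+ x) ℤ.* (+ 6 ℤ.+ x) ℤ.+ d ℤ.+ + 12 ℤ.* (+ 3 ℤ.+ h)
    shift-by-6 x d d′ h eq = begin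
      (+ 9 ℤ.+ x) ℤ.* (+ 9 ℤ.+ x) ℤ.+ d′                           ≡⟨ solve (x ∷ d′ ∷ []) ⟩
      (+ 3 ℤ.+ x) ℤ.* (+ 3 ℤ.+ x) ℤ.+ d′ ℤ.+ (+ 72 ℤ.+ + 12 ℤ.* x) ≡⟨ cong (ℤ._+ (+ 72 ℤ.+ + 12 ℤ.* x)) eq ⟩
      x ℤ.* x ℤ.+ d ℤ.+ + 12 ℤ.* h ℤ.+ (+ 72 ℤ.+ + 12 ℤ.* x)       ≡⟨ solve (x ∷ d ∷ h ∷ []) ⟩
      (+ 6 ℤ.+ x) ℤ.* (+ 6 ℤ.+ x) ℤ.+ d ℤ.+ + 12 ℤ.* (+ 3 ℤ.+ h)   ∎

  twelve-p3 : ∀ n → + 12 ℤ.* + p3 n ≡ + n ℤ.* + n ℤ.+ δ n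
  twelve-p3 0 = refl
  twelve-p3 1 = refl
  twelve-p3 2 = refl
  twelve-p3 (suc (suc (suc n))) = begin
    + 12 ℤ.* + p3 (3 + n)                          ≡⟨ cong (λ k → + 12 ℤ.* + k) (p3-shift n) ⟩
    + 12 ℤ.* (+ p3 n ℤ.+ + suc ⌊ n /2⌋)             ≡⟨ ℤP.*-distribˡ-+ (+ 12) (+ p3 n) (+ suc ⌊ n /2⌋) ⟩
    + 12 ℤ.* + p3 n ℤ.+ + 12 ℤ.* + suc ⌊ n /2⌋      ≡⟨ cong (ℤ._+ + 12 ℤ.* + suc ⌊ n /2⌋) (twelve-p3 n) ⟩
    + n ℤ.* + n ℤ.+ δ n ℤ.+ + 12 ℤ.* + suc ⌊ n /2⌋  ≡⟨ δ-shift n ⟨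
    + (3 + n) ℤ.* + (3 + n) ℤ.+ δ (3 + n)           ∎


module DivisibilityCriterion where

  open PartitionFormula using (δ; δ-mod; twelve-p3)
  open import Data.Nat as ℕ using (ℕ; zero; suc; _<_; _≤_; s≤s; _%_)
  import Data.Nat.Properties as ℕP
  import Data.Nat.Divisibility as ℕ
  open import Data.Nat.DivMod using (m%n<n)
  open import Data.Nat.Primality using (Prime; euclidsLemma)
  open import Data.Integer as ℤ using (ℤ; +_; -_; _+_; _-_; _*_)
  open import Data.Integer.Properties using (abs-*; *-comm; +-identityʳ; neg-involutive; [+m]-[+n]≡m⊖n; ∣⊖∣-≤)
  open import Data.Integer.DivMod using (a≡a%ℕn+[a/ℕn]*n)
  open import Data.Integer.Divisibility.Signed
  open import Data.Integer.Tactic.RingSolver using (solve)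

  -- congruence with signed divisibility, as a record so that both sides can be inferred from a proof
  infix 4 _≡_⟨mod_⟩
  record _≡_⟨mod_⟩ (x y d : ℤ) : Set where
    constructor mod-by
    field divides-difference : d ∣ x - y
  open _≡_⟨mod_⟩ public

  mod-sym : ∀ {x y d} → x ≡ y ⟨mod d ⟩ → y ≡ x ⟨mod d ⟩
  mod-sym {x} {y} {d} (mod-by d∣x-y) = mod-by (subst (d ∣_) -[x-y]≡y-x (∣m⇒∣-m d∣x-y))
    where
    -[x-y]≡y-x : - (x - y) ≡ y - x
    -[x-y]≡y-x = solve (x ∷ y ∷ [])

  mod-trans : ∀ {x y z d} → x ≡ y ⟨mod d ⟩ → y ≡ z ⟨mod d ⟩ → x ≡ z ⟨mod d ⟩
  mod-trans {x} {y} {z} {d} (mod-by d∣x-y) (mod-by d∣y-z) = mod-by (subst (d ∣_) telescope (∣m∣n⇒∣m+n d∣x-y d∣y-z))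
    where
    telescope : (x - y) + (y - z) ≡ x - z
    telescope = solve (x ∷ y ∷ z ∷ [])

  multiple<⇒≡0 : ∀ {d x} → x < d → d ℕ.∣ x → x ≡ 0
  multiple<⇒≡0 {x = zero}  _   _   = refl
  multiple<⇒≡0 {x = suc x} x<d d∣x = contradiction d∣x (ℕ.>⇒∤ x<d)

  residue-unique-≤ : ∀ {d r r′} → r′ < d → r ≤ r′ → + r ≡ + r′ ⟨mod + d ⟩ → r ≡ r′
  residue-unique-≤ {d} {r} {r′} r′<d r≤r′ (mod-by d∣r-r′) =
    ℕP.≤-antisym r≤r′ (ℕP.m∸n≡0⇒m≤n (multiple<⇒≡0 (ℕP.≤-<-trans (ℕP.m∸n≤m r′ r) r′<d) d∣r′∸r))
    where
    d∣r′∸r : d ℕ.∣ r′ ℕ.∸ r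
    d∣r′∸r = subst (d ℕ.∣_) (trans (cong ℤ.∣_∣ ([+m]-[+n]≡m⊖n r r′)) (∣⊖∣-≤ r≤r′)) (∣⇒∣ᵤ d∣r-r′)

  residue-unique : ∀ {d r r′} → r < d → r′ < d → + r ≡ + r′ ⟨mod + d ⟩ → r ≡ r′
  residue-unique {r = r} {r′} r<d r′<d r≡r′ with ℕP.≤-total r r′
  ... | inj₁ r≤r′ = residue-unique-≤ r′<d r≤r′ r≡r′
  ... | inj₂ r′≤r = sym (residue-unique-≤ r<d r′≤r (mod-sym r≡r′))

  n≡n%d : ∀ n d .{{_ : ℕ.NonZero d}} → + n ≡ + (n % d) ⟨mod + d ⟩
  n≡n%d n d = mod-by (divides q (begin
    + n - r           ≡⟨ cong (_- r) (a≡a%ℕn+[a/ℕn]*n (+ n) d) ⟩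
    r + q * + d - r   ≡⟨ +-sub-cancelˡ r (q * + d) ⟩
    q * + d           ∎))
    where
    q r : ℤ
    q = + n ℤ./ℕ d
    r = + (n % d)
    +-sub-cancelˡ : ∀ x y → x + y - x ≡ y
    +-sub-cancelˡ x y = solve (x ∷ y ∷ [])

  δ-cong : ∀ {m n} → + m ≡ + n ⟨mod + 6 ⟩ → δ m ≡ δ n
  δ-cong {m} {n} m≡n = begin
    δ m       ≡⟨ δ-mod m ⟩
    δ (m % 6) ≡⟨ cong δ (residue-unique (m%n<n m 6) (m%n<n n 6) m%6≡n%6) ⟩
    δ (n % 6) ≡⟨ δ-mod n ⟨
    δ n       ∎
    where
    m%6≡n%6 : + (m % 6) ≡ + (n % 6) ⟨mod + 6 ⟩
    m%6≡n%6 = mod-trans (mod-sym (n≡n%d m 6)) (mod-trans m≡n (n≡n%d n 6))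

  mod-weakenˡ : ∀ {x y d e} → x ≡ y ⟨mod d * e ⟩ → x ≡ y ⟨mod d ⟩
  mod-weakenˡ {e = e} (mod-by de∣x-y) = mod-by (∣-trans (∣m⇒∣m*n e ∣-refl) de∣x-y)

  mod-weakenʳ : ∀ {x y d e} → x ≡ y ⟨mod d * e ⟩ → x ≡ y ⟨mod e ⟩
  mod-weakenʳ {d = d} (mod-by de∣x-y) = mod-by (∣-trans (∣n⇒∣m*n d ∣-refl) de∣x-y)

  mod-square : ∀ {x y d} → x ≡ y ⟨mod d ⟩ → x * x ≡ y * y ⟨mod d ⟩
  mod-square {x} {y} {d} (mod-by d∣x-y) = mod-by (subst (d ∣_) factor (∣n⇒∣m*n (x + y) d∣x-y))
    where
    factor : (x + y) * (x - y) ≡ x * x - y * y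
    factor = solve (x ∷ y ∷ [])

  Euclid : ℤ → Set
  Euclid p = ∀ x y → p ∣ x * y → p ∣ x ⊎ p ∣ y

  euclidsLemmaℤ : ∀ {p} → Prime p → Euclid (+ p)
  euclidsLemmaℤ p-prime x y p∣xy =
    Sum.map ∣ᵤ⇒∣ ∣ᵤ⇒∣ (euclidsLemma ℤ.∣ x ∣ ℤ.∣ y ∣ p-prime (subst (_ ℕ.∣_) (abs-* x y) (∣⇒∣ᵤ p∣xy)))

  module _ {p : ℤ} (euclid : Euclid p) where

    ∣-cancelˡ : ∀ {k x} → ¬ p ∣ k → p ∣ k * x → p ∣ x
    ∣-cancelˡ p∤k p∣kx = Sum.fromInj₂ (⊥-elim ∘ p∤k) (euclid _ _ p∣kx)

    square-roots : ∀ {x b b′} → p ∣ b + b′ → x * x ≡ b * b ⟨mod p ⟩ → x ≡ b ⟨mod p ⟩ ⊎ x ≡ b′ ⟨mod p ⟩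
    square-roots {x} {b} {b′} p∣b+b′ (mod-by p∣x²-b²) =
      Sum.map mod-by (λ p∣x+b → mod-by (subst (p ∣_) shift (∣m∣n⇒∣m-n p∣x+b p∣b+b′)))
              (euclid (x - b) (x + b) (subst (p ∣_) factor p∣x²-b²))
      where
      factor : x * x - b * b ≡ (x - b) * (x + b)
      factor = solve (x ∷ b ∷ [])
      shift : x + b - (b + b′) ≡ x - b′
      shift = solve (x ∷ b ∷ b′ ∷ [])

    mod-combine : ∀ {x y d} → ¬ p ∣ d → x ≡ y ⟨mod d ⟩ → x ≡ y ⟨mod p ⟩ → x ≡ y ⟨mod d * p ⟩
    mod-combine {x} {y} {d} p∤d (mod-by (divides q x-y≡qd)) (mod-by p∣x-y) = mod-by (divides u (begin
      x - y       ≡⟨ x-y≡qd ⟩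
      q * d       ≡⟨ cong (_* d) q≡up ⟩
      u * p * d   ≡⟨ reorder u p d ⟩
      u * (d * p) ∎))
      where
      p∣q : p ∣ q
      p∣q = ∣-cancelˡ p∤d (subst (p ∣_) (trans x-y≡qd (*-comm q d)) p∣x-y)
      u : ℤ
      u = quotient p∣q
      q≡up : q ≡ u * p
      q≡up = _∣_.equality p∣q
      reorder : ∀ u p d → u * p * d ≡ u * (d * p)
      reorder u p d = solve (u ∷ p ∷ d ∷ [])

  module Anchors (M s : ℤ) where

    Sign : ℤ → Set
    Sign ε = ε ≡ + 1 ⊎ ε ≡ - + 1

    Anchor : ℤ → Set
    Anchor a = a ≡ + 0 ⊎ a ≡ + 1 ⊎ a ≡ + 2 ⊎ a ≡ + 2 * M - + 1 ⊎ a ≡ + 2 * M + + 2 ⊎ a ≡ + 3 * M + s * (M - + 1)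

    SignedAnchor : Set
    SignedAnchor = Σ[ ε ∈ ℤ ] Sign ε × Σ[ a ∈ ℤ ] Anchor a

    value : SignedAnchor → ℤ
    value (ε , _ , a , _) = ε * a

    a₀ : Anchor (+ 0)
    a₀ = inj₁ refl
    a₁ : Anchor (+ 1)
    a₁ = inj₂ (inj₁ refl)
    a₂ : Anchor (+ 2)
    a₂ = inj₂ (inj₂ (inj₁ refl))
    a₃ : Anchor (+ 2 * M - + 1)
    a₃ = inj₂ (inj₂ (inj₂ (inj₁ refl)))
    a₄ : Anchor (+ 2 * M + + 2)
    a₄ = inj₂ (inj₂ (inj₂ (inj₂ (inj₁ refl))))
    a₅ : Anchor (+ 3 * M + s * (M - + 1))
    a₅ = inj₂ (inj₂ (inj₂ (inj₂ (inj₂ refl))))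

    +[_] -[_] : ∀ {a} → Anchor a → SignedAnchor
    +[_] {a} anchor = + 1 , inj₁ refl , a , anchor
    -[_] {a} anchor = - + 1 , inj₂ refl , a , anchor

    Represented : ℕ → Set
    Represented n = Σ[ σ ∈ SignedAnchor ] + n ≡ value σ ⟨mod + 6 * M ⟩

  module Roots (M : ℤ) (M≡1 : M ≡ + 1 ⟨mod + 6 ⟩) (s : ℤ) (s²≡-3 : s * s ≡ - + 3 ⟨mod M ⟩) where

    open Anchors M s public

    Root : ℕ → ℤ → Set
    Root r b = b ≡ + r ⟨mod + 6 ⟩ × b * b ≡ - δ r ⟨mod M ⟩

    -- x - r = k (M - 1) + 6 l shows x ≡ r (mod 6) because 6 ∣ M - 1; q is the quotient of x² + δ r by M
    private
      residue-by : ∀ x r (k l : ℤ) → x - + r ≡ k * (M - + 1) + l * + 6 → x ≡ + r ⟨mod + 6 ⟩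
      residue-by x r k l x-r≡ =
        mod-by (subst (+ 6 ∣_) (sym x-r≡) (∣m∣n⇒∣m+n (∣n⇒∣m*n k (divides-difference M≡1)) (∣n⇒∣m*n l ∣-refl)))

      root-by : ∀ x r (k l q : ℤ) → x - + r ≡ k * (M - + 1) + l * + 6 → x * x - - δ r ≡ q * M → Root r x
      root-by x r k l q x-r≡ x²+δr≡ = residue-by x r k l x-r≡ , mod-by (divides q x²+δr≡)

      -- the sixth anchor is congruent to -s modulo M
      square-via-s : ∀ x q → x * x - s * s ≡ q * M → x * x ≡ - δ 3 ⟨mod M ⟩
      square-via-s x q x²-s²≡ = mod-trans (mod-by (divides q x²-s²≡)) s²≡-3

    root : (σ : SignedAnchor) → Σ[ r ∈ ℕ ] Root r (value σ)
    root (_ , inj₁ refl , _ , inj₁ refl) = 0 , root-by (+ 1 * + 0) 0 (+ 0) (+ 0) (+ 0) refl refl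
    root (_ , inj₂ refl , _ , inj₁ refl) = 0 , root-by (- + 1 * + 0) 0 (+ 0) (+ 0) (+ 0) refl refl
    root (_ , inj₁ refl , _ , inj₂ (inj₁ refl)) = 1 , root-by (+ 1 * + 1) 1 (+ 0) (+ 0) (+ 0) refl refl
    root (_ , inj₂ refl , _ , inj₂ (inj₁ refl)) = 5 , root-by (- + 1 * + 1) 5 (+ 0) (- + 1) (+ 0) refl refl
    root (_ , inj₁ refl , _ , inj₂ (inj₂ (inj₁ refl))) = 2 , root-by (+ 1 * + 2) 2 (+ 0) (+ 0) (+ 0) refl refl
    root (_ , inj₂ refl , _ , inj₂ (inj₂ (inj₁ refl))) = 4 , root-by (- + 1 * + 2) 4 (+ 0) (- + 1) (+ 0) refl refl
    root (_ , inj₁ refl , _ , inj₂ (inj₂ (inj₂ (inj₁ refl)))) =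
      1 , root-by (+ 1 * (+ 2 * M - + 1)) 1 (+ 2) (+ 0) (+ 4 * M - + 4) (solve (M ∷ [])) (solve (M ∷ []))
    root (_ , inj₂ refl , _ , inj₂ (inj₂ (inj₂ (inj₁ refl)))) =
      5 , root-by (- + 1 * (+ 2 * M - + 1)) 5 (- + 2) (- + 1) (+ 4 * M - + 4) (solve (M ∷ [])) (solve (M ∷ []))
    root (_ , inj₁ refl , _ , inj₂ (inj₂ (inj₂ (inj₂ (inj₁ refl))))) =
      4 , root-by (+ 1 * (+ 2 * M + + 2)) 4 (+ 2) (+ 0) (+ 4 * M + + 8) (solve (M ∷ [])) (solve (M ∷ []))
    root (_ , inj₂ refl , _ , inj₂ (inj₂ (inj₂ (inj₂ (inj₁ refl))))) =
      2 , root-by (- + 1 * (+ 2 * M + + 2)) 2 (- + 2) (- + 1) (+ 4 * M + + 8) (solve (M ∷ [])) (solve (M ∷ []))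
    root (_ , inj₁ refl , _ , inj₂ (inj₂ (inj₂ (inj₂ (inj₂ refl))))) =
      3 , residue-by (+ 1 * (+ 3 * M + s * (M - + 1))) 3 (+ 3 + s) (+ 0) (solve (M ∷ s ∷ [])) ,
          square-via-s (+ 1 * (+ 3 * M + s * (M - + 1))) ((+ 3 + s) * (+ 3 * M + s * (M - + 1) - s)) (solve (M ∷ s ∷ []))
    root (_ , inj₂ refl , _ , inj₂ (inj₂ (inj₂ (inj₂ (inj₂ refl))))) =
      3 , residue-by (- + 1 * (+ 3 * M + s * (M - + 1))) 3 (- (+ 3 + s)) (- + 1) (solve (M ∷ s ∷ [])) ,
          square-via-s (- + 1 * (+ 3 * M + s * (M - + 1))) ((+ 3 + s) * (+ 3 * M + s * (M - + 1) - s)) (solve (M ∷ s ∷ []))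

    roots-over : ∀ r → r < 6 → Σ[ σ ∈ SignedAnchor ] Σ[ τ ∈ SignedAnchor ]
                   Root r (value σ) × value τ ≡ + r ⟨mod + 6 ⟩ × M ∣ value σ + value τ
    roots-over 0 _ = +[ a₀ ] , -[ a₀ ] , proj₂ (root +[ a₀ ]) , proj₁ (proj₂ (root -[ a₀ ])) , divides (+ 0) refl
    roots-over 1 _ = +[ a₁ ] , +[ a₃ ] , proj₂ (root +[ a₁ ]) , proj₁ (proj₂ (root +[ a₃ ])) ,
      divides (+ 2) ((+ 1 * + 1 + + 1 * (+ 2 * M - + 1) ≡ + 2 * M) ∋ solve (M ∷ []))
    roots-over 2 _ = +[ a₂ ] , -[ a₄ ] , proj₂ (root +[ a₂ ]) , proj₁ (proj₂ (root -[ a₄ ])) ,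
      divides (- + 2) ((+ 1 * + 2 + - + 1 * (+ 2 * M + + 2) ≡ - + 2 * M) ∋ solve (M ∷ []))
    roots-over 3 _ = +[ a₅ ] , -[ a₅ ] , proj₂ (root +[ a₅ ]) , proj₁ (proj₂ (root -[ a₅ ])) ,
      divides (+ 0) ((+ 1 * (+ 3 * M + s * (M - + 1)) + - + 1 * (+ 3 * M + s * (M - + 1)) ≡ + 0 * M) ∋ solve (M ∷ s ∷ []))
    roots-over 4 _ = +[ a₄ ] , -[ a₂ ] , proj₂ (root +[ a₄ ]) , proj₁ (proj₂ (root -[ a₂ ])) ,
      divides (+ 2) ((+ 1 * (+ 2 * M + + 2) + - + 1 * + 2 ≡ + 2 * M) ∋ solve (M ∷ []))
    roots-over 5 _ = -[ a₁ ] , -[ a₃ ] , proj₂ (root -[ a₁ ]) , proj₁ (proj₂ (root -[ a₃ ])) ,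
      divides (- + 2) ((- + 1 * + 1 + - + 1 * (+ 2 * M - + 1) ≡ - + 2 * M) ∋ solve (M ∷ []))
    roots-over (suc (suc (suc (suc (suc (suc _)))))) (s≤s (s≤s (s≤s (s≤s (s≤s (s≤s ()))))))

  module Representation (M : ℤ) (M≡1 : M ≡ + 1 ⟨mod + 6 ⟩) (s : ℤ) (s²≡-3 : s * s ≡ - + 3 ⟨mod M ⟩)
                        (euclid : Euclid M) (M∤2 : ¬ M ∣ + 2) (M∤3 : ¬ M ∣ + 3) where

    open Roots M M≡1 s s²≡-3 public

    M∤6 : ¬ M ∣ + 6
    M∤6 = Sum.[ M∤2 , M∤3 ] ∘ euclid (+ 2) (+ 3)

    M∤12 : ¬ M ∣ + 12
    M∤12 = Sum.[ M∤2 , M∤6 ] ∘ euclid (+ 2) (+ 6)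

    root⇒represented : ∀ n → + n * + n ≡ - δ n ⟨mod M ⟩ → Represented n
    root⇒represented n n²≡-δn with roots-over (n % 6) (m%n<n n 6)
    ... | σ , τ , (σ≡r , σ²≡-δr) , τ≡r , M∣σ+τ
        with square-roots euclid M∣σ+τ
               (mod-trans (subst (λ d → + n * + n ≡ - d ⟨mod M ⟩) (δ-mod n) n²≡-δn) (mod-sym σ²≡-δr))
    ... | inj₁ n≡σ = σ , mod-combine euclid M∤6 (mod-trans (n≡n%d n 6) (mod-sym σ≡r)) n≡σ
    ... | inj₂ n≡τ = τ , mod-combine euclid M∤6 (mod-trans (n≡n%d n 6) (mod-sym τ≡r)) n≡τ

    represented⇒root : ∀ n → Represented n → + n * + n ≡ - δ n ⟨mod M ⟩
    represented⇒root n (σ , n≡σ) with root σ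
    ... | r , σ≡r , σ²≡-δr =
      subst (λ d → + n * + n ≡ - d ⟨mod M ⟩) (sym (δ-cong (mod-trans (mod-weakenˡ {e = M} n≡σ) σ≡r)))
            (mod-trans (mod-square (mod-weakenʳ {d = + 6} n≡σ)) σ²≡-δr)

    p3≡0⇔n²≡-δ : ∀ n → + p3 n ≡ + 0 ⟨mod M ⟩ ⇔ + n * + n ≡ - δ n ⟨mod M ⟩
    p3≡0⇔n²≡-δ n = mk⇔
      (λ (mod-by M∣p3) → mod-by (subst (M ∣_) 12p3≡ (∣n⇒∣m*n (+ 12) (subst (M ∣_) (+-identityʳ (+ p3 n)) M∣p3))))
      (λ (mod-by M∣n²+δn) → mod-by (subst (M ∣_) (sym (+-identityʳ (+ p3 n)))
                                    (∣-cancelˡ euclid M∤12 (subst (M ∣_) (sym 12p3≡) M∣n²+δn))))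
      where
      12p3≡ : + 12 * + p3 n ≡ + n * + n - - δ n
      12p3≡ = trans (twelve-p3 n) (cong (_+_ (+ n * + n)) (sym (neg-involutive (δ n))))

    p3≡0⇔represented : ∀ n → + p3 n ≡ + 0 ⟨mod M ⟩ ⇔ Represented n
    p3≡0⇔represented n = mk⇔ (root⇒represented n ∘ Equivalence.to (p3≡0⇔n²≡-δ n))
                              (Equivalence.from (p3≡0⇔n²≡-δ n) ∘ represented⇒root n)


open DivisibilityCriterion
open import Data.Nat using (ℕ; _≤_; _+_; _*_; s≤s; NonZero)
open import Data.Nat.Primality using (Prime)
open import Data.Integer as ℤ using (ℤ; +_; -_)
import Data.Nat.Properties as ℕP
import Data.Nat.Divisibility as ℕ
open import Data.Integer.Properties using (pos-*; +-assoc; +-identityʳ; *-comm)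
open import Data.Integer.Divisibility.Signed using (_∣_; divides; ∣ᵤ⇒∣; ∣⇒∣ᵤ)
open import Function.Construct.Composition using (_⇔-∘_)

mod⇔⟨mod⟩ : ∀ {x y d} → x ≡ y [mod d ] ⇔ x ≡ y ⟨mod d ⟩
mod⇔⟨mod⟩ = mk⇔ (mod-by ∘ ∣ᵤ⇒∣) (∣⇒∣ᵤ ∘ divides-difference)

[6j+1]-1≡6j : ∀ j → + (6 * j + 1) ℤ.- + 1 ≡ + (6 * j)
[6j+1]-1≡6j j = trans (+-assoc (+ (6 * j)) (+ 1) (- + 1)) (+-identityʳ (+ (6 * j)))

6j+1≡1 : ∀ j → + (6 * j + 1) ≡ + 1 ⟨mod + 6 ⟩
6j+1≡1 j = mod-by (divides (+ j) (trans ([6j+1]-1≡6j j) (trans (pos-* 6 j) (*-comm (+ 6) (+ j)))))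

module _ (j : ℕ) (s : ℤ) where

  private
    m : ℕ
    m = 6 * j + 1

  open Anchors (+ m) s

  StatementAnchor : ℤ → Set
  StatementAnchor a = a ≡ + 0 ⊎ a ≡ + 1 ⊎ a ≡ + 2 ⊎ a ≡ + (2 * (6 * j + 1)) ℤ.- + 1
          ⊎ a ≡ + (2 * (6 * j + 1) + 2)
          ⊎ a ≡ + (3 * (6 * j + 1)) ℤ.+ s ℤ.* + (6 * j)

  StatementRepresented : ℕ → Set
  StatementRepresented n = Σ ℤ (λ ε → (ε ≡ + 1 ⊎ ε ≡ - (+ 1)) × Σ ℤ (λ a →
    StatementAnchor a × (+ n) ≡ ε ℤ.* a [mod (+ (6 * (6 * j + 1))) ]))

  private
    a₃≡ : + (2 * m) ℤ.- + 1 ≡ + 2 ℤ.* + m ℤ.- + 1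
    a₃≡ = cong (ℤ._- + 1) (pos-* 2 m)

    a₄≡ : + (2 * m + 2) ≡ + 2 ℤ.* + m ℤ.+ + 2
    a₄≡ = cong (ℤ._+ + 2) (pos-* 2 m)

    a₅≡ : + (3 * m) ℤ.+ s ℤ.* + (6 * j) ≡ + 3 ℤ.* + m ℤ.+ s ℤ.* (+ m ℤ.- + 1)
    a₅≡ = cong₂ ℤ._+_ (pos-* 3 m) (cong (s ℤ.*_) (sym ([6j+1]-1≡6j j)))

    fromStatementAnchor : ∀ {a} → StatementAnchor a → Anchor a
    fromStatementAnchor = Sum.map₂ (Sum.map₂ (Sum.map₂
      (Sum.map (λ e → trans e a₃≡) (Sum.map (λ e → trans e a₄≡) (λ e → trans e a₅≡)))))

    toStatementAnchor : ∀ {a} → Anchor a → StatementAnchor a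
    toStatementAnchor = Sum.map₂ (Sum.map₂ (Sum.map₂
      (Sum.map (λ e → trans e (sym a₃≡)) (Sum.map (λ e → trans e (sym a₄≡)) (λ e → trans e (sym a₅≡))))))

  represented⇔statement : ∀ n → Represented n ⇔ StatementRepresented n
  represented⇔statement n = mk⇔
    (λ ((ε , sign , a , anchor) , n≡εa) → ε , sign , a , toStatementAnchor anchor ,
       Equivalence.from mod⇔⟨mod⟩ (subst (λ d → + n ≡ ε ℤ.* a ⟨mod d ⟩) (sym (pos-* 6 m)) n≡εa))
    (λ (ε , sign , a , anchor , n≡εa) → (ε , sign , a , fromStatementAnchor anchor) ,
       subst (λ d → + n ≡ ε ℤ.* a ⟨mod d ⟩) (pos-* 6 m) (Equivalence.to mod⇔⟨mod⟩ n≡εa))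

proposition2 : (j : ℕ) → 1 ≤ j → Prime (6 * j + 1) →
    (s : ℤ) → (s ℤ.* s) ≡ (- (+ 3)) [mod (+ (6 * j + 1)) ] →
    (n : ℕ) →
    (((+ (p3 n)) ≡ (+ 0) [mod (+ (6 * j + 1)) ]) →
      Σ ℤ (λ ε → (ε ≡ + 1 ⊎ ε ≡ - (+ 1)) × Σ ℤ (λ a →
        (a ≡ + 0 ⊎ a ≡ + 1 ⊎ a ≡ + 2 ⊎ a ≡ + (2 * (6 * j + 1)) ℤ.- + 1
          ⊎ a ≡ + (2 * (6 * j + 1) + 2)
          ⊎ a ≡ + (3 * (6 * j + 1)) ℤ.+ s ℤ.* + (6 * j))
        × (+ n) ≡ ε ℤ.* a [mod (+ (6 * (6 * j + 1))) ])))
    × (Σ ℤ (λ ε → (ε ≡ + 1 ⊎ ε ≡ - (+ 1)) × Σ ℤ (λ a →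
        (a ≡ + 0 ⊎ a ≡ + 1 ⊎ a ≡ + 2 ⊎ a ≡ + (2 * (6 * j + 1)) ℤ.- + 1
          ⊎ a ≡ + (2 * (6 * j + 1) + 2)
          ⊎ a ≡ + (3 * (6 * j + 1)) ℤ.+ s ℤ.* + (6 * j))
        × (+ n) ≡ ε ℤ.* a [mod (+ (6 * (6 * j + 1))) ]))
      → (+ (p3 n)) ≡ (+ 0) [mod (+ (6 * j + 1)) ])
proposition2 j 1≤j m-prime s s²≡-3 n = Equivalence.to criterion , Equivalence.from criterion
  where
  m : ℕ
  m = 6 * j + 1

  m∤ : ∀ k .{{_ : NonZero k}} → k ≤ 6 → ¬ + m ∣ + k
  m∤ k k≤6 = ℕ.>⇒∤ (ℕP.≤-trans (s≤s k≤6) (ℕP.+-monoˡ-≤ 1 (ℕP.*-monoʳ-≤ 6 1≤j))) ∘ ∣⇒∣ᵤ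

  open Representation (+ m) (6j+1≡1 j) s (Equivalence.to mod⇔⟨mod⟩ s²≡-3)
                      (euclidsLemmaℤ m-prime) (m∤ 2 (ℕP.m≤m+n 2 4)) (m∤ 3 (ℕP.m≤m+n 3 3))

  criterion : ((+ p3 n) ≡ + 0 [mod + m ]) ⇔ StatementRepresented j s n
  criterion = represented⇔statement j s n ⇔-∘ (p3≡0⇔represented n ⇔-∘ mod⇔⟨mod⟩)
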